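{- Let $p\ge 11$ be a prime. Then $$\binom{2p-1}{p-1}\equiv 1-2p\sum_{k=1}^{p-1}\frac{1}{k}+4p^2\sum_{1\le i<j\le p-1}\frac{1}{ij}\pmod{p^7}.$$
   Context: For rational numbers $a,b$ whose denominators are not divisible by the prime $p$, and a positive integer $m$, $a\equiv b\pmod{p^m}$ means that $a-b=p^m c$ for some rational number $c$ whose denominator is not divisible by $p$. -}

module Defs where

open import Data.Nat as ℕ using (ℕ; zero; suc)
open import Data.Nat.Divisibility using (_∣_)
open import Data.Integer as ℤ using (ℤ; +_)
open import Data.Rational using (ℚ; _+_; _-_; _*_; _/_; ↧ₙ_; 0ℚ)
open import Data.List using (List; []; _∷_; map; foldr; concatMap)
open import Data.Product using (∃; _×_)
open import Relation.Binary.PropositionalEquality using (_≡_)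
open import Relation.Nullary using (¬_)

nℚ : ℕ → ℚ
nℚ n = + n / 1

sumℚ : List ℚ → ℚ
sumℚ = foldr _+_ 0ℚ

range : ℕ → ℕ → List ℕ
range a zero = []
range a (suc len) = a ∷ range (suc a) len

oneTo : ℕ → List ℕ
oneTo n = range 1 n

-- Σ_{k=1}^{n} 1/k   (k ≥ 1, so suc (pred k) = k)
harmonic : ℕ → ℚ
harmonic n = sumℚ (map (λ k → + 1 / suc (ℕ.pred k)) (oneTo n))

pairSum : ℕ → ℚ
pairSum n = sumℚ (concatMap (λ j → map (λ i → + 1 / suc (ℕ.pred (i ℕ.* j))) (oneTo (ℕ.pred j))) (oneTo n))

pIntegral : ℕ → ℚ → Set
pIntegral p a = ¬ (p ∣ (↧ₙ a))

CongModPow : ℕ → ℕ → ℚ → ℚ → Set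
CongModPow p m a b =
  pIntegral p a × pIntegral p b × ∃ λ (c : ℚ) → pIntegral p c × (a - b ≡ nℚ (p ℕ.^ m) * c)

-- Write p = 2m + 1 and q = p − 1. Pairing the factor p + i with p + (p − i) turns
-- q! · C(2p − 1, p − 1) = (p + 1)(p + 2) ⋯ (p + q) into ∏_{i=1}^{m} (V + z_i), where
-- V = 2p² and z_i = i (p − i); this is G(V) for G = ∏ (X + z_i) = ∑ c_j X^j.
-- The same pairing in ℤ[t]/(t³), applied to ∏_{k=1}^{q} (k + t) = q! (1 + H t + E t²)
-- with H = ∑ 1/k and E = ∑_{i<j} 1/(ij), gives q! = c₀, q! H = p c₁ and q! E = c₁ + p² c₂.
-- Hence q! times the difference of the two sides is V³ c₃ + V⁴ (…), and it remains to
-- show p ∣ c₃ = e_{m−3}(z). Since z_i ≡ −i² (mod p), ∑ z_i^r ≡ ±∑_{i≤m} i^{2r}, and twice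
-- the latter is ∑_{k<p} k^{2r} ≡ 0 (mod p) for 1 ≤ r < m; Newton's identities carry this
-- over to the elementary symmetric functions e_j(z) with j < m.

module Submission where

open import Algebra.Core using (Op₂)
open import Algebra.Structures using (IsCommutativeMonoid)
open import Algebra.Bundles using (CommutativeMonoid)
open import Relation.Binary.Bundles using (Setoid)
import Relation.Binary.Reasoning.Setoid
open import Level using (0ℓ)
open import Data.Nat as ℕ using (ℕ; zero; suc; _≤_; _<_; _!; z≤n; s≤s)
import Data.Nat.Properties as ℕ
open import Data.Nat.Primality using (Prime; euclidsLemma; prime⇒nonTrivial; prime⇒irreducible)
open import Data.Integer as ℤ using (ℤ; 0ℤ; 1ℤ)
import Data.Integer.Properties as ℤ
open import Data.Integer.Tactic.RingSolver using (solve-∀)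
open import Data.Rational as ℚ using (ℚ; _/_; toℚᵘ; 1ℚ)
import Data.Rational.Properties as ℚ
open import Data.List using (List; []; _∷_; _++_; length; map; concat; concatMap; applyUpTo; drop)
import Data.List.Properties as List
open import Data.Product using (Σ; _×_; _,_; proj₁; proj₂)
open import Data.Sum using (_⊎_; inj₁; inj₂)
open import Relation.Nullary using (¬_; contradiction)
open import Relation.Binary.PropositionalEquality
open import Defs

module BigOperator {A : Set} {_∙_ : Op₂ A} {ε : A}
                   (isCommutativeMonoid : IsCommutativeMonoid _≡_ _∙_ ε) where

  open import Data.Nat using (_+_; _∸_)
  open IsCommutativeMonoid isCommutativeMonoid using (assoc; comm; identityˡ; identityʳ)

  private
    commutativeMonoid : CommutativeMonoid 0ℓ 0ℓ
    commutativeMonoid = record { isCommutativeMonoid = isCommutativeMonoid }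

  open import Algebra.Properties.CommutativeSemigroup (CommutativeMonoid.commutativeSemigroup commutativeMonoid)
    using (interchange)

  big : ℕ → (ℕ → A) → A
  big zero    f = ε
  big (suc n) f = f 0 ∙ big n (λ i → f (suc i))

  big-cong : ∀ n {f g : ℕ → A} → (∀ i → i < n → f i ≡ g i) → big n f ≡ big n g
  big-cong zero    f≡g = refl
  big-cong (suc n) f≡g = cong₂ _∙_ (f≡g 0 (s≤s z≤n)) (big-cong n (λ i i<n → f≡g (suc i) (s≤s i<n)))

  big-identity : ∀ n {f : ℕ → A} → (∀ i → f i ≡ ε) → big n f ≡ ε
  big-identity zero    f≡ε = refl
  big-identity (suc n) f≡ε = trans (cong₂ _∙_ (f≡ε 0) (big-identity n (λ i → f≡ε (suc i)))) (identityˡ ε)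

  big-suc : ∀ n f → big (suc n) f ≡ big n f ∙ f n
  big-suc zero    f = trans (identityʳ (f 0)) (sym (identityˡ (f 0)))
  big-suc (suc n) f = trans (cong (f 0 ∙_) (big-suc n (λ i → f (suc i)))) (sym (assoc _ _ _))

  big-∙ : ∀ n f g → big n (λ i → f i ∙ g i) ≡ big n f ∙ big n g
  big-∙ zero    f g = sym (identityˡ ε)
  big-∙ (suc n) f g = trans (cong ((f 0 ∙ g 0) ∙_) (big-∙ n _ _)) (interchange _ _ _ _)

  big-+ : ∀ m n f → big (m + n) f ≡ big m f ∙ big n (λ i → f (m + i))
  big-+ zero    n f = sym (identityˡ _)
  big-+ (suc m) n f = trans (cong (f 0 ∙_) (big-+ m n (λ i → f (suc i)))) (sym (assoc _ _ _))

  big-reverse : ∀ n f → big n f ≡ big n (λ i → f (n ∸ suc i))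
  big-reverse zero    f = refl
  big-reverse (suc n) f = begin
      f 0 ∙ big n (λ i → f (suc i))
    ≡⟨ cong (f 0 ∙_) (big-reverse n (λ i → f (suc i))) ⟩
      f 0 ∙ big n (λ i → f (suc (n ∸ suc i)))
    ≡⟨ comm _ _ ⟩
      big n (λ i → f (suc (n ∸ suc i))) ∙ f 0
    ≡⟨ cong₂ _∙_ (big-cong n (λ i i<n → cong f (sym (ℕ.+-∸-assoc 1 i<n))))
                 (cong f (sym (ℕ.n∸n≡0 n))) ⟩
      big n (λ i → f (n ∸ i)) ∙ f (n ∸ n)
    ≡⟨ sym (big-suc n (λ i → f (suc n ∸ suc i))) ⟩
      big (suc n) (λ i → f (suc n ∸ suc i))
    ∎
    where open ≡-Reasoning

  big-pairEnds : ∀ m f → big (m + m) f ≡ big m (λ i → f i ∙ f (m + m ∸ suc i))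
  big-pairEnds m f = begin
      big (m + m) f
    ≡⟨ big-+ m m f ⟩
      big m f ∙ big m (λ i → f (m + i))
    ≡⟨ cong (big m f ∙_) (big-reverse m (λ i → f (m + i))) ⟩
      big m f ∙ big m (λ i → f (m + (m ∸ suc i)))
    ≡⟨ cong (big m f ∙_) (big-cong m (λ i i<m → cong f (sym (ℕ.+-∸-assoc m i<m)))) ⟩
      big m f ∙ big m (λ i → f (m + m ∸ suc i))
    ≡⟨ sym (big-∙ m _ _) ⟩
      big m (λ i → f i ∙ f (m + m ∸ suc i))
    ∎
    where open ≡-Reasoning

module _ {A B : Set} {_∙_ : Op₂ A} {ε : A} {_∘_ : Op₂ B} {ε′ : B}
         (M : IsCommutativeMonoid _≡_ _∙_ ε) (N : IsCommutativeMonoid _≡_ _∘_ ε′) where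

  open BigOperator M using (big)
  open BigOperator N using () renaming (big to big′)

  big-homomorphic : ∀ (h : A → B) → h ε ≡ ε′ → (∀ x y → h (x ∙ y) ≡ h x ∘ h y) →
                    ∀ n f → h (big n f) ≡ big′ n (λ i → h (f i))
  big-homomorphic h h-ε h-∙ zero    f = h-ε
  big-homomorphic h h-ε h-∙ (suc n) f =
    trans (h-∙ (f 0) _) (cong (h (f 0) ∘_) (big-homomorphic h h-ε h-∙ n (λ i → f (suc i))))

-- Power sums modulo a prime

module _ where

  open import Data.Nat using (_+_; _*_; _^_)
  open import Data.Nat.Divisibility
    using (_∣_; ∣-refl; _∣0; ∣m∣n⇒∣m+n; ∣m+n∣m⇒∣n; ∣m⇒∣m*n; ∣n⇒∣m*n; >⇒∤)
  open import Data.Nat.Combinatorics using (_C_; nCk+nC[k+1]≡[n+1]C[k+1]; nCn≡1; nCk≡nC[n∸k]; nC1≡n)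
  open import Data.Nat.Combinatorics.Specification using (k>n⇒nCk≡0)
  open import Data.Nat.Induction using (<-rec)
  open import Algebra.Properties.CommutativeSemigroup ℕ.*-commutativeSemigroup using (x∙yz≈y∙xz)

  open BigOperator ℕ.+-0-isCommutativeMonoid public
    using ()
    renaming (big to sumℕ; big-cong to sumℕ-cong; big-identity to sumℕ-zero; big-suc to sumℕ-suc; big-∙ to sumℕ-+)

  sumℕ-*ˡ : ∀ n c f → sumℕ n (λ i → c * f i) ≡ c * sumℕ n f
  sumℕ-*ˡ n c f = sym (big-homomorphic ℕ.+-0-isCommutativeMonoid ℕ.+-0-isCommutativeMonoid
                          (c *_) (ℕ.*-zeroʳ c) (ℕ.*-distribˡ-+ c) n f)

  ∣-sumℕ : ∀ {d} n f → (∀ i → i < n → d ∣ f i) → d ∣ sumℕ n f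
  ∣-sumℕ {d} zero    f d∣f = d ∣0
  ∣-sumℕ     (suc n) f d∣f =
    ∣m∣n⇒∣m+n (d∣f 0 (s≤s z≤n)) (∣-sumℕ n _ (λ i i<n → d∣f (suc i) (s≤s i<n)))

  binomial : ∀ n x → suc x ^ n ≡ sumℕ (suc n) (λ i → (n C i) * x ^ i)
  binomial zero    x = refl
  binomial (suc n) x = begin
      suc x * suc x ^ n
    ≡⟨ cong (suc x *_) (binomial n x) ⟩
      (1 + sumℕ n (λ i → g (suc i))) + x * sumℕ (suc n) g
    ≡⟨ cong₂ (λ s t → (1 + s) + t) (extend-by-zero) (sym (sumℕ-*ˡ (suc n) x g)) ⟩
      (1 + sumℕ (suc n) (λ i → g (suc i))) + sumℕ (suc n) (λ i → x * g i)
    ≡⟨ reorder (sumℕ (suc n) (λ i → g (suc i))) (sumℕ (suc n) (λ i → x * g i)) ⟩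
      1 + (sumℕ (suc n) (λ i → x * g i) + sumℕ (suc n) (λ i → g (suc i)))
    ≡⟨ cong (1 +_) (sym (sumℕ-+ (suc n) (λ i → x * g i) (λ i → g (suc i)))) ⟩
      1 + sumℕ (suc n) (λ i → x * g i + g (suc i))
    ≡⟨ cong (1 +_) (sumℕ-cong (suc n) (λ i _ → pascal i)) ⟩
      sumℕ (suc (suc n)) (λ i → (suc n C i) * x ^ i)
    ∎
    where
    open ≡-Reasoning
    g : ℕ → ℕ
    g i = (n C i) * x ^ i
    extend-by-zero : sumℕ n (λ i → g (suc i)) ≡ sumℕ (suc n) (λ i → g (suc i))
    extend-by-zero = sym (begin
        sumℕ (suc n) (λ i → g (suc i))
      ≡⟨ sumℕ-suc n (λ i → g (suc i)) ⟩
        sumℕ n (λ i → g (suc i)) + (n C suc n) * x ^ suc n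
      ≡⟨ cong (sumℕ n (λ i → g (suc i)) +_) (cong (_* x ^ suc n) (k>n⇒nCk≡0 (ℕ.n<1+n n))) ⟩
        sumℕ n (λ i → g (suc i)) + 0
      ≡⟨ ℕ.+-identityʳ _ ⟩
        sumℕ n (λ i → g (suc i))
      ∎)
    reorder : ∀ a b → (1 + a) + b ≡ 1 + (b + a)
    reorder a b = cong suc (ℕ.+-comm a b)
    pascal : ∀ i → x * g i + g (suc i) ≡ (suc n C suc i) * x ^ suc i
    pascal i = begin
        x * ((n C i) * x ^ i) + (n C suc i) * x ^ suc i
      ≡⟨ cong (_+ (n C suc i) * x ^ suc i) (x∙yz≈y∙xz x (n C i) (x ^ i)) ⟩
        (n C i) * x ^ suc i + (n C suc i) * x ^ suc i
      ≡⟨ sym (ℕ.*-distribʳ-+ (x ^ suc i) (n C i) (n C suc i)) ⟩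
        (n C i + n C suc i) * x ^ suc i
      ≡⟨ cong (_* x ^ suc i) (nCk+nC[k+1]≡[n+1]C[k+1] n i) ⟩
        (suc n C suc i) * x ^ suc i
      ∎

  powerSum : ℕ → ℕ → ℕ
  powerSum s N = sumℕ N (λ k → k ^ s)

  -- ∑_{k<N} ((k + 1)^(s+1) − k^(s+1)) telescopes to N^(s+1).
  binomial-powerSum : ∀ s N → sumℕ (suc s) (λ i → (suc s C i) * powerSum i N) ≡ N ^ suc s
  binomial-powerSum s zero    = sumℕ-zero (suc s) (λ i → ℕ.*-zeroʳ (suc s C i))
  binomial-powerSum s (suc N) = begin
      sumℕ (suc s) (λ i → (suc s C i) * powerSum i (suc N))
    ≡⟨ sumℕ-cong (suc s) (λ i _ → trans (cong ((suc s C i) *_) (sumℕ-suc N (λ k → k ^ i)))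
                                        (ℕ.*-distribˡ-+ (suc s C i) (powerSum i N) (N ^ i))) ⟩
      sumℕ (suc s) (λ i → (suc s C i) * powerSum i N + (suc s C i) * N ^ i)
    ≡⟨ sumℕ-+ (suc s) (λ i → (suc s C i) * powerSum i N) (λ i → (suc s C i) * N ^ i) ⟩
      sumℕ (suc s) (λ i → (suc s C i) * powerSum i N) + sumℕ (suc s) (λ i → (suc s C i) * N ^ i)
    ≡⟨ cong (_+ sumℕ (suc s) (λ i → (suc s C i) * N ^ i)) (binomial-powerSum s N) ⟩
      N ^ suc s + sumℕ (suc s) (λ i → (suc s C i) * N ^ i)
    ≡⟨ ℕ.+-comm (N ^ suc s) _ ⟩
      sumℕ (suc s) (λ i → (suc s C i) * N ^ i) + N ^ suc s
    ≡⟨ cong (sumℕ (suc s) (λ i → (suc s C i) * N ^ i) +_)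
            (sym (trans (cong (_* N ^ suc s) (nCn≡1 (suc s))) (ℕ.*-identityˡ _))) ⟩
      sumℕ (suc s) (λ i → (suc s C i) * N ^ i) + (suc s C suc s) * N ^ suc s
    ≡⟨ sym (sumℕ-suc (suc s) (λ i → (suc s C i) * N ^ i)) ⟩
      sumℕ (suc (suc s)) (λ i → (suc s C i) * N ^ i)
    ≡⟨ sym (binomial (suc s) N) ⟩
      suc N ^ suc s
    ∎
    where open ≡-Reasoning

  prime∣*-cancelˡ : ∀ {p m n} → Prime p → ¬ p ∣ m → p ∣ m * n → p ∣ n
  prime∣*-cancelˡ {m = m} {n} pr p∤m p∣mn with euclidsLemma m n pr p∣mn
  ... | inj₁ p∣m = contradiction p∣m p∤m
  ... | inj₂ p∣n = p∣n

  -- By strong induction on s: in binomial-powerSum with N = p every term but the last,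
  -- (s + 1) · powerSum s p, is divisible by p, and p ∤ s + 1.
  prime∣powerSum : ∀ {p} → Prime p → ∀ s → suc s < p → p ∣ powerSum s p
  prime∣powerSum {p} pr = <-rec _ step
    where
    step : ∀ s → (∀ {i} → i < s → suc i < p → p ∣ powerSum i p) → suc s < p → p ∣ powerSum s p
    step s ih s+1<p = prime∣*-cancelˡ pr (>⇒∤ s+1<p) p∣last
      where
      F : ℕ → ℕ
      F i = (suc s C i) * powerSum i p
      p∣init : p ∣ sumℕ s F
      p∣init = ∣-sumℕ s F (λ i i<s → ∣n⇒∣m*n (suc s C i) (ih i<s (ℕ.<-trans (s≤s i<s) s+1<p)))
      p∣all : p ∣ sumℕ s F + F s
      p∣all = subst (p ∣_) (trans (sym (binomial-powerSum s p)) (sumℕ-suc s F)) (∣m⇒∣m*n (p ^ s) ∣-refl)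
      s+1Cs≡s+1 : suc s C s ≡ suc s
      s+1Cs≡s+1 = trans (nCk≡nC[n∸k] (ℕ.n≤1+n s)) (trans (cong (suc s C_) (ℕ.m+n∸n≡m 1 s)) (nC1≡n (suc s)))
      p∣last : p ∣ suc s * powerSum s p
      p∣last = subst (λ c → p ∣ c * powerSum s p) s+1Cs≡s+1 (∣m+n∣m⇒∣n p∣all p∣init)

module _ where

  open import Data.Nat using (_+_; _*_; _∸_)
  open import Data.Nat.DivMod using (m/n*n≡m)
  open import Data.Nat.Divisibility using (_∣_; divides; >⇒∤)
  open import Data.Nat.Combinatorics using (_C_; nCk≡n!/k![n-k]!; k![n∸k]!∣n!)
  open import Algebra.Properties.CommutativeSemigroup ℕ.*-commutativeSemigroup using (x∙yz≈y∙xz)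

  open BigOperator ℕ.*-1-isCommutativeMonoid public using () renaming (big to prodℕ; big-suc to prodℕ-suc)

  binomial-factorial : ∀ {n k} → k ≤ n → (n C k) * (k ! * (n ∸ k) !) ≡ n !
  binomial-factorial {n} {k} k≤n =
    trans (cong (_* (k ! * (n ∸ k) !)) (nCk≡n!/k![n-k]! k≤n))
          (m/n*n≡m {{ℕ._!*_!≢0 k (n ∸ k)}} (k![n∸k]!∣n! k≤n))

  factorial-+ : ∀ a j → (a + j) ! ≡ a ! * prodℕ j (λ i → a + suc i)
  factorial-+ a zero    = trans (cong _! (ℕ.+-identityʳ a)) (sym (ℕ.*-identityʳ (a !)))
  factorial-+ a (suc j) = begin
      (a + suc j) !
    ≡⟨ cong _! (ℕ.+-suc a j) ⟩
      suc (a + j) * (a + j) !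
    ≡⟨ cong (suc (a + j) *_) (factorial-+ a j) ⟩
      suc (a + j) * (a ! * Π)
    ≡⟨ x∙yz≈y∙xz (suc (a + j)) (a !) Π ⟩
      a ! * (suc (a + j) * Π)
    ≡⟨ cong (λ t → a ! * (t * Π)) (sym (ℕ.+-suc a j)) ⟩
      a ! * ((a + suc j) * Π)
    ≡⟨ cong (a ! *_) (trans (ℕ.*-comm (a + suc j) Π) (sym (prodℕ-suc j (λ i → a + suc i)))) ⟩
      a ! * prodℕ (suc j) (λ i → a + suc i)
    ∎
    where
    open ≡-Reasoning
    Π = prodℕ j (λ i → a + suc i)

  binomial-prodℕ : ∀ a j → ((a + j) C j) * j ! ≡ prodℕ j (λ i → a + suc i)
  binomial-prodℕ a j = ℕ.*-cancelʳ-≡ _ _ (a !) {{ℕ._!≢0 a}} (begin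
      ((a + j) C j) * j ! * a !
    ≡⟨ ℕ.*-assoc ((a + j) C j) (j !) (a !) ⟩
      ((a + j) C j) * (j ! * a !)
    ≡⟨ cong (λ t → ((a + j) C j) * (j ! * t !)) (sym (ℕ.m+n∸n≡m a j)) ⟩
      ((a + j) C j) * (j ! * (a + j ∸ j) !)
    ≡⟨ binomial-factorial (ℕ.m≤n+m j a) ⟩
      (a + j) !
    ≡⟨ factorial-+ a j ⟩
      a ! * prodℕ j (λ i → a + suc i)
    ≡⟨ ℕ.*-comm (a !) _ ⟩
      prodℕ j (λ i → a + suc i) * a !
    ∎)
    where open ≡-Reasoning

  prime∤factorial : ∀ {p} → Prime p → ∀ n → n < p → ¬ p ∣ n !
  prime∤factorial {p} pr zero    n<p = >⇒∤ (ℕ.nonTrivial⇒n>1 p {{prime⇒nonTrivial pr}})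
  prime∤factorial     pr (suc n) n<p p∣n! =
    prime∤factorial pr n (ℕ.<-trans (ℕ.n<1+n n) n<p) (prime∣*-cancelˡ pr (>⇒∤ n<p) p∣n!)

  even-or-odd : ∀ n → Σ ℕ (λ m → n ≡ m ℕ.+ m ⊎ n ≡ suc (m ℕ.+ m))
  even-or-odd zero = 0 , inj₁ refl
  even-or-odd (suc n) with even-or-odd n
  ... | m , inj₁ n≡2m   = m , inj₂ (cong suc n≡2m)
  ... | m , inj₂ n≡2m+1 = suc m , inj₁ (cong suc (trans n≡2m+1 (sym (ℕ.+-suc m m))))

  odd-prime : ∀ {p} → Prime p → 2 < p → Σ ℕ (λ m → p ≡ suc (m ℕ.+ m))
  odd-prime {p} pr 2<p with even-or-odd p
  ... | m , inj₂ p≡2m+1 = m , p≡2m+1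
  ... | m , inj₁ refl with prime⇒irreducible pr (divides m (trans (cong (m +_) (sym (ℕ.+-identityʳ m))) (ℕ.*-comm 2 m)))
  ...   | inj₁ ()
  ...   | inj₂ 2≡p = contradiction 2≡p (ℕ.<⇒≢ 2<p)

module _ where

  open import Data.Integer using (+_; _+_; _-_; _*_; -_; _^_)
  open import Data.Integer.Divisibility.Signed using (_∣_; divides; ∣m∣n⇒∣m+n; ∣m⇒∣-m; ∣n⇒∣m*n)

  open BigOperator ℤ.+-0-isCommutativeMonoid public using () renaming (big to sumℤ)

  infix 4 _≡_mod_
  record _≡_mod_ (a b d : ℤ) : Set where
    constructor mk≡mod
    field ∣a-b : d ∣ a - b

  module _ {d : ℤ} where

    ≡⇒≡-mod : ∀ {a b} → a ≡ b → a ≡ b mod d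
    ≡⇒≡-mod {a} refl = mk≡mod (subst (d ∣_) (sym (ℤ.+-inverseʳ a)) (divides 0ℤ refl))

    mod-sym : ∀ {a b} → a ≡ b mod d → b ≡ a mod d
    mod-sym {a} {b} (mk≡mod d∣a-b) = mk≡mod (subst (d ∣_) (lemma a b) (∣m⇒∣-m d∣a-b))
      where
      lemma : ∀ a b → - (a - b) ≡ b - a
      lemma = solve-∀

    mod-trans : ∀ {a b c} → a ≡ b mod d → b ≡ c mod d → a ≡ c mod d
    mod-trans {a} {b} {c} (mk≡mod d∣a-b) (mk≡mod d∣b-c) =
      mk≡mod (subst (d ∣_) (lemma a b c) (∣m∣n⇒∣m+n d∣a-b d∣b-c))
      where
      lemma : ∀ a b c → (a - b) + (b - c) ≡ a - c
      lemma = solve-∀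

    mod-+ : ∀ {a b a′ b′} → a ≡ b mod d → a′ ≡ b′ mod d → a + a′ ≡ b + b′ mod d
    mod-+ {a} {b} {a′} {b′} (mk≡mod d∣a-b) (mk≡mod d∣a′-b′) =
      mk≡mod (subst (d ∣_) (lemma a b a′ b′) (∣m∣n⇒∣m+n d∣a-b d∣a′-b′))
      where
      lemma : ∀ a b a′ b′ → (a - b) + (a′ - b′) ≡ (a + a′) - (b + b′)
      lemma = solve-∀

    mod-* : ∀ {a b a′ b′} → a ≡ b mod d → a′ ≡ b′ mod d → a * a′ ≡ b * b′ mod d
    mod-* {a} {b} {a′} {b′} (mk≡mod d∣a-b) (mk≡mod d∣a′-b′) =
      mk≡mod (subst (d ∣_) (lemma a b a′ b′) (∣m∣n⇒∣m+n (∣n⇒∣m*n a′ d∣a-b) (∣n⇒∣m*n b d∣a′-b′)))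
      where
      lemma : ∀ a b a′ b′ → a′ * (a - b) + b * (a′ - b′) ≡ a * a′ - b * b′
      lemma = solve-∀

    mod-^ : ∀ {a b} r → a ≡ b mod d → a ^ r ≡ b ^ r mod d
    mod-^ zero    a≡b = ≡⇒≡-mod refl
    mod-^ (suc r) a≡b = mod-* a≡b (mod-^ r a≡b)

    mod-sum : ∀ n {f g} → (∀ i → i < n → f i ≡ g i mod d) → sumℤ n f ≡ sumℤ n g mod d
    mod-sum zero    f≡g = ≡⇒≡-mod refl
    mod-sum (suc n) f≡g = mod-+ (f≡g 0 (s≤s z≤n)) (mod-sum n (λ i i<n → f≡g (suc i) (s≤s i<n)))

    ∣⇒≡0-mod : ∀ {a} → d ∣ a → a ≡ 0ℤ mod d
    ∣⇒≡0-mod {a} d∣a = mk≡mod (subst (d ∣_) (sym (ℤ.+-identityʳ a)) d∣a)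

    ≡0-mod⇒∣ : ∀ {a} → a ≡ 0ℤ mod d → d ∣ a
    ≡0-mod⇒∣ {a} (mk≡mod d∣a) = subst (d ∣_) (ℤ.+-identityʳ a) d∣a

  ≡-mod-setoid : ℤ → Setoid 0ℓ 0ℓ
  ≡-mod-setoid d = record
    { Carrier       = ℤ
    ; _≈_           = λ a b → a ≡ b mod d
    ; isEquivalence = record { refl = ≡⇒≡-mod refl ; sym = mod-sym ; trans = mod-trans }
    }

  module ≡-mod-Reasoning (d : ℤ) = Relation.Binary.Reasoning.Setoid (≡-mod-setoid d)

  sumℤ-*ˡ : ∀ n c f → sumℤ n (λ i → c * f i) ≡ c * sumℤ n f
  sumℤ-*ˡ n c f = sym (big-homomorphic ℤ.+-0-isCommutativeMonoid ℤ.+-0-isCommutativeMonoid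
                         (c *_) (ℤ.*-zeroʳ c) (ℤ.*-distribˡ-+ c) n f)

  pos-^ : ∀ a n → + (a ℕ.^ n) ≡ (+ a) ^ n
  pos-^ a zero    = refl
  pos-^ a (suc n) = trans (ℤ.pos-* a (a ℕ.^ n)) (cong (+ a *_) (pos-^ a n))

  ^-distribʳ-* : ∀ a b r → (a * b) ^ r ≡ a ^ r * b ^ r
  ^-distribʳ-* a b zero    = refl
  ^-distribʳ-* a b (suc r) = trans (cong ((a * b) *_) (^-distribʳ-* a b r)) (interchange a b (a ^ r) (b ^ r))
    where
    interchange : ∀ a b c d → (a * b) * (c * d) ≡ (a * c) * (b * d)
    interchange = solve-∀

  ^-double : ∀ a r → a ^ (r ℕ.+ r) ≡ (a * a) ^ r
  ^-double a r = trans (ℤ.^-distribˡ-+-* a r r) (sym (^-distribʳ-* a a r))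

-- Newton's identities

module _ where

  open import Data.Integer using (+_; _+_; _*_; -_; _^_)
  import Data.Nat.Divisibility as ℕ
  open import Data.Integer.Divisibility.Signed using (_∣_; ∣ᵤ⇒∣; ∣⇒∣ᵤ; ∣m∣n⇒∣m+n; ∣m⇒∣m*n; ∣n⇒∣m*n)
  open import Algebra.Properties.CommutativeSemigroup ℤ.*-commutativeSemigroup using (x∙yz≈y∙xz)

  elementary : List ℤ → ℕ → ℤ
  elementary L       zero    = 1ℤ
  elementary []      (suc k) = 0ℤ
  elementary (x ∷ L) (suc k) = elementary L (suc k) + x * elementary L k

  powerSumOf : List ℤ → ℕ → ℤ
  powerSumOf []      i = 0ℤ
  powerSumOf (x ∷ L) i = x ^ i + powerSumOf L i

  -- convolution f g j = ∑_{i ≤ j} f i * g (j ∸ i)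
  convolution : (ℕ → ℤ) → (ℕ → ℤ) → ℕ → ℤ
  convolution f g zero    = f 0 * g 0
  convolution f g (suc j) = f 0 * g (suc j) + convolution (λ i → f (suc i)) g j

  shift : (ℕ → ℤ) → ℕ → ℤ
  shift g zero    = 0ℤ
  shift g (suc j) = g j

  private
    +-interchange : ∀ a b c d → (a + b) + (c + d) ≡ (a + c) + (b + d)
    +-interchange = solve-∀

  convolution-congˡ : ∀ j {f f′ g} → (∀ i → f i ≡ f′ i) → convolution f g j ≡ convolution f′ g j
  convolution-congˡ zero    f≡f′ = cong (_* _) (f≡f′ 0)
  convolution-congˡ (suc j) f≡f′ = cong₂ _+_ (cong (_* _) (f≡f′ 0)) (convolution-congˡ j (λ i → f≡f′ (suc i)))

  convolution-congʳ : ∀ j {f g g′} → (∀ i → g i ≡ g′ i) → convolution f g j ≡ convolution f g′ j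
  convolution-congʳ zero    {f} g≡g′ = cong (f 0 *_) (g≡g′ 0)
  convolution-congʳ (suc j) {f} g≡g′ = cong₂ _+_ (cong (f 0 *_) (g≡g′ (suc j))) (convolution-congʳ j g≡g′)

  convolution-distribˡ-+ : ∀ j f f′ g →
    convolution (λ i → f i + f′ i) g j ≡ convolution f g j + convolution f′ g j
  convolution-distribˡ-+ zero    f f′ g = ℤ.*-distribʳ-+ (g 0) (f 0) (f′ 0)
  convolution-distribˡ-+ (suc j) f f′ g =
    trans (cong₂ _+_ (ℤ.*-distribʳ-+ (g (suc j)) (f 0) (f′ 0))
                     (convolution-distribˡ-+ j (λ i → f (suc i)) (λ i → f′ (suc i)) g))
          (+-interchange (f 0 * g (suc j)) (f′ 0 * g (suc j)) _ _)

  convolution-distribʳ-+ : ∀ j f g g′ →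
    convolution f (λ i → g i + g′ i) j ≡ convolution f g j + convolution f g′ j
  convolution-distribʳ-+ zero    f g g′ = ℤ.*-distribˡ-+ (f 0) (g 0) (g′ 0)
  convolution-distribʳ-+ (suc j) f g g′ =
    trans (cong₂ _+_ (ℤ.*-distribˡ-+ (f 0) (g (suc j)) (g′ (suc j)))
                     (convolution-distribʳ-+ j (λ i → f (suc i)) g g′))
          (+-interchange (f 0 * g (suc j)) (f 0 * g′ (suc j)) _ _)

  convolution-*ˡ : ∀ j c f g → convolution (λ i → c * f i) g j ≡ c * convolution f g j
  convolution-*ˡ zero    c f g = ℤ.*-assoc c (f 0) (g 0)
  convolution-*ˡ (suc j) c f g =
    trans (cong₂ _+_ (ℤ.*-assoc c (f 0) (g (suc j))) (convolution-*ˡ j c _ g)) (sym (ℤ.*-distribˡ-+ c _ _))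

  convolution-*ʳ : ∀ j c f g → convolution f (λ i → c * g i) j ≡ c * convolution f g j
  convolution-*ʳ zero    c f g = x∙yz≈y∙xz (f 0) c (g 0)
  convolution-*ʳ (suc j) c f g =
    trans (cong₂ _+_ (x∙yz≈y∙xz (f 0) c (g (suc j))) (convolution-*ʳ j c _ g)) (sym (ℤ.*-distribˡ-+ c _ _))

  convolution-zeroˡ : ∀ j f g → (∀ i → f i ≡ 0ℤ) → convolution f g j ≡ 0ℤ
  convolution-zeroˡ zero    f g f≡0 = cong (_* g 0) (f≡0 0)
  convolution-zeroˡ (suc j) f g f≡0 =
    cong₂ _+_ (cong (_* g (suc j)) (f≡0 0)) (convolution-zeroˡ j _ g (λ i → f≡0 (suc i)))

  convolution-shift : ∀ j f g → convolution f (shift g) (suc j) ≡ convolution f g j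
  convolution-shift zero    f g = trans (cong (_+_ (f 0 * g 0)) (ℤ.*-zeroʳ (f 1))) (ℤ.+-identityʳ _)
  convolution-shift (suc j) f g = cong (_+_ (f 0 * g (suc j))) (convolution-shift j (λ i → f (suc i)) g)

  elementary-∷ : ∀ x L k → elementary (x ∷ L) k ≡ elementary L k + x * shift (elementary L) k
  elementary-∷ x L zero    = sym (trans (cong (_+_ 1ℤ) (ℤ.*-zeroʳ x)) (ℤ.+-identityʳ 1ℤ))
  elementary-∷ x L (suc k) = refl

  signedPowerSum : List ℤ → ℕ → ℤ
  signedPowerSum L i = (- 1ℤ) ^ i * powerSumOf L (suc i)

  signedPower : ℤ → ℕ → ℤ
  signedPower x i = (- 1ℤ) ^ i * x ^ suc i

  signedPowerSum-∷ : ∀ x L i → signedPowerSum (x ∷ L) i ≡ signedPower x i + signedPowerSum L i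
  signedPowerSum-∷ x L i = ℤ.*-distribˡ-+ ((- 1ℤ) ^ i) (x ^ suc i) (powerSumOf L (suc i))

  -- The contribution of a single variable x telescopes, since signedPower x (i + 1) = − x · signedPower x i.
  convolution-signedPower : ∀ x h j →
    convolution (signedPower x) h j + x * convolution (signedPower x) (shift h) j ≡ x * h j
  convolution-signedPower x h zero = lemma x (h 0)
    where
    lemma : ∀ x a → 1ℤ * (x * 1ℤ) * a + x * (1ℤ * (x * 1ℤ) * 0ℤ) ≡ x * a
    lemma = solve-∀
  convolution-signedPower x h (suc j) = begin
      (q 0 * h (suc j) + convolution (λ i → q (suc i)) h j) + x * convolution q (shift h) (suc j)
    ≡⟨ cong₂ (λ a b → (q 0 * h (suc j) + a) + x * b)
         (trans (convolution-congˡ j q-suc) (convolution-*ˡ j (- x) q h))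
         (convolution-shift j q h) ⟩
      (q 0 * h (suc j) + (- x) * convolution q h j) + x * convolution q h j
    ≡⟨ cancel x (h (suc j)) (convolution q h j) ⟩
      x * h (suc j)
    ∎
    where
    open ≡-Reasoning
    q = signedPower x
    q-suc : ∀ i → q (suc i) ≡ (- x) * q i
    q-suc i = lemma ((- 1ℤ) ^ i) x (x ^ i)
      where
      lemma : ∀ s x y → (- 1ℤ * s) * (x * (x * y)) ≡ (- x) * (s * (x * y))
      lemma = solve-∀
    cancel : ∀ x a c → (1ℤ * (x * 1ℤ) * a + (- x) * c) + x * c ≡ x * a
    cancel = solve-∀

  newton : ∀ L j → + suc j * elementary L (suc j) ≡ convolution (signedPowerSum L) (elementary L) j
  newton []      j = trans (ℤ.*-zeroʳ (+ suc j))
                           (sym (convolution-zeroˡ j _ (elementary []) (λ i → ℤ.*-zeroʳ ((- 1ℤ) ^ i))))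
  newton (x ∷ L) j = sym (begin
      convolution f′ (elementary (x ∷ L)) j
    ≡⟨ convolution-congʳ j (elementary-∷ x L) ⟩
      convolution f′ (λ k → e k + x * shift e k) j
    ≡⟨ convolution-distribʳ-+ j f′ e (λ k → x * shift e k) ⟩
      convolution f′ e j + convolution f′ (λ k → x * shift e k) j
    ≡⟨ cong (_+_ (convolution f′ e j)) (convolution-*ʳ j x f′ (shift e)) ⟩
      convolution f′ e j + x * convolution f′ (shift e) j
    ≡⟨ cong₂ (λ a b → a + x * b) (split e) (split (shift e)) ⟩
      (convolution q e j + convolution f e j) + x * (convolution q (shift e) j + convolution f (shift e) j)
    ≡⟨ regroup (convolution q e j) (convolution f e j) (convolution q (shift e) j) (convolution f (shift e) j) x ⟩
      (convolution q e j + x * convolution q (shift e) j) + (convolution f e j + x * convolution f (shift e) j)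
    ≡⟨ cong (_+ (convolution f e j + x * convolution f (shift e) j)) (convolution-signedPower x e j) ⟩
      x * e j + (convolution f e j + x * convolution f (shift e) j)
    ≡⟨ cong (λ c → x * e j + (c + x * convolution f (shift e) j)) (sym (newton L j)) ⟩
      x * e j + (+ suc j * e (suc j) + x * convolution f (shift e) j)
    ≡⟨ cong (λ c → x * e j + (+ suc j * e (suc j) + x * c)) (shifted j) ⟩
      x * e j + (+ suc j * e (suc j) + x * (+ j * e j))
    ≡⟨ collect x (e j) (e (suc j)) (+ j) ⟩
      (1ℤ + + j) * (e (suc j) + x * e j)
    ≡⟨ cong (_* elementary (x ∷ L) (suc j)) (sym (ℤ.pos-+ 1 j)) ⟩
      + suc j * elementary (x ∷ L) (suc j)
    ∎)
    where
    open ≡-Reasoning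
    e = elementary L
    f = signedPowerSum L
    f′ = signedPowerSum (x ∷ L)
    q = signedPower x
    split : ∀ g → convolution f′ g j ≡ convolution q g j + convolution f g j
    split g = trans (convolution-congˡ j (signedPowerSum-∷ x L)) (convolution-distribˡ-+ j q f g)
    shifted : ∀ j → convolution f (shift e) j ≡ + j * e j
    shifted zero    = trans (ℤ.*-zeroʳ (f 0)) (sym (ℤ.*-zeroˡ (e 0)))
    shifted (suc j) = trans (convolution-shift j f e) (sym (newton L j))
    regroup : ∀ a b c d x → (a + b) + x * (c + d) ≡ (a + x * c) + (b + x * d)
    regroup = solve-∀
    collect : ∀ x a b n → x * a + ((1ℤ + n) * b + x * (n * a)) ≡ (1ℤ + n) * (b + x * a)
    collect = solve-∀

  ∣-convolution : ∀ {d} j f g → (∀ i → i ≤ j → d ∣ f i) → d ∣ convolution f g j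
  ∣-convolution zero    f g d∣f = ∣m⇒∣m*n (g 0) (d∣f 0 z≤n)
  ∣-convolution (suc j) f g d∣f =
    ∣m∣n⇒∣m+n (∣m⇒∣m*n (g (suc j)) (d∣f 0 z≤n)) (∣-convolution j _ g (λ i i≤j → d∣f (suc i) (s≤s i≤j)))

  prime∣*-cancelˡ-ℤ : ∀ {p n e} → Prime p → ¬ p ℕ.∣ n → + p ∣ + n * e → + p ∣ e
  prime∣*-cancelˡ-ℤ {p} {n} {e} pr p∤n p∣ne =
    ∣ᵤ⇒∣ (prime∣*-cancelˡ pr p∤n (subst (p ℕ.∣_) (ℤ.abs-* (+ n) e) (∣⇒∣ᵤ p∣ne)))

  prime∣elementary : ∀ {p} → Prime p → ∀ L J → J < p → (∀ i → 1 ≤ i → i ≤ J → + p ∣ powerSumOf L i) →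
                     ∀ j → 1 ≤ j → j ≤ J → + p ∣ elementary L j
  prime∣elementary pr L J J<p p∣powerSum (suc j) _ j<J =
    prime∣*-cancelˡ-ℤ pr (ℕ.>⇒∤ (ℕ.≤-<-trans j<J J<p))
      (subst (_ ∣_) (sym (newton L j))
        (∣-convolution j (signedPowerSum L) (elementary L)
          (λ i i≤j → ∣n⇒∣m*n ((- 1ℤ) ^ i) (p∣powerSum (suc i) (s≤s z≤n) (ℕ.≤-trans (s≤s i≤j) j<J)))))

  powerSumOf-applyUpTo : ∀ n f r → powerSumOf (applyUpTo f n) r ≡ sumℤ n (λ i → f i ^ r)
  powerSumOf-applyUpTo zero    f r = refl
  powerSumOf-applyUpTo (suc n) f r = cong (_+_ (f 0 ^ r)) (powerSumOf-applyUpTo n (λ i → f (suc i)) r)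

module _ where

  open import Data.Nat using (_∸_)
  open import Data.Integer using (+_; _+_; _*_)

  open BigOperator ℤ.*-1-isCommutativeMonoid public using () renaming (big to prodℤ)

  -- Coefficients are listed from the constant one upwards.
  eval : List ℤ → ℤ → ℤ
  eval []       v = 0ℤ
  eval (c ∷ cs) v = c + v * eval cs v

  coeff : ℕ → List ℤ → ℤ
  coeff j       []       = 0ℤ
  coeff zero    (c ∷ cs) = c
  coeff (suc j) (c ∷ cs) = coeff j cs

  mulLinear′ : ℤ → ℤ → List ℤ → List ℤ
  mulLinear′ z c []        = c ∷ []
  mulLinear′ z c (c′ ∷ cs) = z * c′ + c ∷ mulLinear′ z c′ cs

  mulLinear : ℤ → List ℤ → List ℤ
  mulLinear z = mulLinear′ z 0ℤ

  -- linearProduct L = ∏_{z ∈ L} (X + z)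
  linearProduct : List ℤ → List ℤ
  linearProduct []      = 1ℤ ∷ []
  linearProduct (z ∷ L) = mulLinear z (linearProduct L)

  eval-mulLinear′ : ∀ z c cs v → eval (mulLinear′ z c cs) v ≡ c + (v + z) * eval cs v
  eval-mulLinear′ z c []        v = lemma c v z
    where
    lemma : ∀ c v z → c + v * 0ℤ ≡ c + (v + z) * 0ℤ
    lemma = solve-∀
  eval-mulLinear′ z c (c′ ∷ cs) v =
    trans (cong (λ e → (z * c′ + c) + v * e) (eval-mulLinear′ z c′ cs v)) (lemma z c c′ v (eval cs v))
    where
    lemma : ∀ z c c′ v e → (z * c′ + c) + v * (c′ + (v + z) * e) ≡ c + (v + z) * (c′ + v * e)
    lemma = solve-∀

  coeff-mulLinear′ : ∀ j z c cs → coeff j (mulLinear′ z c cs) ≡ z * coeff j cs + coeff j (c ∷ cs)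
  coeff-mulLinear′ zero    z c []        = sym (trans (cong (_+ c) (ℤ.*-zeroʳ z)) (ℤ.+-identityˡ c))
  coeff-mulLinear′ (suc j) z c []        = sym (trans (cong (_+ 0ℤ) (ℤ.*-zeroʳ z)) (ℤ.+-identityˡ 0ℤ))
  coeff-mulLinear′ zero    z c (c′ ∷ cs) = refl
  coeff-mulLinear′ (suc j) z c (c′ ∷ cs) = coeff-mulLinear′ j z c′ cs

  eval-linearProduct : ∀ n f v → eval (linearProduct (applyUpTo f n)) v ≡ prodℤ n (λ k → v + f k)
  eval-linearProduct zero    f v = trans (cong (_+_ 1ℤ) (ℤ.*-zeroʳ v)) (ℤ.+-identityʳ 1ℤ)
  eval-linearProduct (suc n) f v =
    trans (eval-mulLinear′ (f 0) 0ℤ (linearProduct (applyUpTo (λ i → f (suc i)) n)) v)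
          (trans (ℤ.+-identityˡ _) (cong ((v + f 0) *_) (eval-linearProduct n (λ i → f (suc i)) v)))

  coeff-linearProduct-∷ : ∀ j z L →
    coeff j (linearProduct (z ∷ L)) ≡ z * coeff j (linearProduct L) + coeff j (0ℤ ∷ linearProduct L)
  coeff-linearProduct-∷ j z L = coeff-mulLinear′ j z 0ℤ (linearProduct L)

  elementary-high : ∀ L k → length L < k → elementary L k ≡ 0ℤ
  elementary-high []      (suc k) _         = refl
  elementary-high (x ∷ L) (suc k) (s≤s n<k) =
    trans (cong₂ (λ a b → a + x * b) (elementary-high L (suc k) (ℕ.m<n⇒m<1+n n<k)) (elementary-high L k n<k))
          (trans (ℤ.+-identityˡ (x * 0ℤ)) (ℤ.*-zeroʳ x))

  coeff-linearProduct-high : ∀ L j → length L < j → coeff j (linearProduct L) ≡ 0ℤ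
  coeff-linearProduct-high []      (suc j) _         = refl
  coeff-linearProduct-high (z ∷ L) (suc j) (s≤s n<j) =
    trans (coeff-linearProduct-∷ (suc j) z L)
          (trans (cong₂ (λ a b → z * a + b) (coeff-linearProduct-high L (suc j) (ℕ.m<n⇒m<1+n n<j))
                                            (coeff-linearProduct-high L j n<j))
                 (trans (ℤ.+-identityʳ (z * 0ℤ)) (ℤ.*-zeroʳ z)))

  coeff-linearProduct : ∀ L k → k ≤ length L → coeff (length L ∸ k) (linearProduct L) ≡ elementary L k
  coeff-linearProduct []      zero    _ = refl
  coeff-linearProduct (z ∷ L) zero    _ =
    trans (coeff-linearProduct-∷ (suc (length L)) z L)
          (trans (cong₂ (λ a b → z * a + b) (coeff-linearProduct-high L (suc (length L)) ℕ.≤-refl)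
                                            (coeff-linearProduct L 0 z≤n))
                 (cong (_+ 1ℤ) (ℤ.*-zeroʳ z)))
  coeff-linearProduct (z ∷ L) (suc k) (s≤s k≤n) =
    trans (coeff-linearProduct-∷ (length L ∸ k) z L)
          (trans (cong₂ (λ a b → z * a + b) (coeff-linearProduct L k k≤n) (next (ℕ.m≤n⇒m<n∨m≡n k≤n)))
                 (ℤ.+-comm (z * elementary L k) (elementary L (suc k))))
    where
    next : k < length L ⊎ k ≡ length L → coeff (length L ∸ k) (0ℤ ∷ linearProduct L) ≡ elementary L (suc k)
    next (inj₁ k<n)  = subst (λ i → coeff i (0ℤ ∷ linearProduct L) ≡ elementary L (suc k))
                             (sym (ℕ.+-∸-assoc 1 k<n)) (coeff-linearProduct L (suc k) k<n)
    next (inj₂ refl) = subst (λ i → coeff i (0ℤ ∷ linearProduct L) ≡ elementary L (suc k))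
                             (sym (ℕ.n∸n≡0 k)) (sym (elementary-high L (suc k) ℕ.≤-refl))

  eval-drop : ∀ k cs v → eval (drop k cs) v ≡ coeff k cs + v * eval (drop (suc k) cs) v
  eval-drop zero    []       v = sym (trans (ℤ.+-identityˡ (v * 0ℤ)) (ℤ.*-zeroʳ v))
  eval-drop (suc k) []       v = sym (trans (ℤ.+-identityˡ (v * 0ℤ)) (ℤ.*-zeroʳ v))
  eval-drop zero    (c ∷ cs) v = refl
  eval-drop (suc k) (c ∷ cs) v = eval-drop k cs v

  eval-split₄ : ∀ cs v → eval cs v ≡
    coeff 0 cs + v * (coeff 1 cs + v * (coeff 2 cs + v * (coeff 3 cs + v * eval (drop 4 cs) v)))
  eval-split₄ cs v =
    trans (eval-drop 0 cs v) (cong (λ e → coeff 0 cs + v * e)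
    (trans (eval-drop 1 cs v) (cong (λ e → coeff 1 cs + v * e)
    (trans (eval-drop 2 cs v) (cong (λ e → coeff 2 cs + v * e)
    (eval-drop 3 cs v))))))

-- Truncated polynomials

module _ where

  open import Data.Integer using (+_; _+_; _*_)

  -- ℤ[t]/(t³): (a₀ , a₁ , a₂) stands for a₀ + a₁ t + a₂ t².
  Trunc₃ : Set
  Trunc₃ = ℤ × ℤ × ℤ

  infixl 7 _⊗_
  _⊗_ : Trunc₃ → Trunc₃ → Trunc₃
  (a₀ , a₁ , a₂) ⊗ (b₀ , b₁ , b₂) = a₀ * b₀ , a₀ * b₁ + a₁ * b₀ , (a₀ * b₂ + a₁ * b₁) + a₂ * b₀

  1₃ : Trunc₃
  1₃ = 1ℤ , 0ℤ , 0ℤ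

  private
    triple-≡ : ∀ {a₀ a₁ a₂ b₀ b₁ b₂ : ℤ} →
               a₀ ≡ b₀ → a₁ ≡ b₁ → a₂ ≡ b₂ → (a₀ , a₁ , a₂) ≡ (b₀ , b₁ , b₂)
    triple-≡ refl refl refl = refl

  ⊗-assoc : ∀ x y z → (x ⊗ y) ⊗ z ≡ x ⊗ (y ⊗ z)
  ⊗-assoc (a₀ , a₁ , a₂) (b₀ , b₁ , b₂) (c₀ , c₁ , c₂) =
    triple-≡ (l₀ a₀ b₀ c₀) (l₁ a₀ a₁ b₀ b₁ c₀ c₁) (l₂ a₀ a₁ a₂ b₀ b₁ b₂ c₀ c₁ c₂)
    where
    l₀ : ∀ a₀ b₀ c₀ → (a₀ * b₀) * c₀ ≡ a₀ * (b₀ * c₀)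
    l₀ = solve-∀
    l₁ : ∀ a₀ a₁ b₀ b₁ c₀ c₁ →
         (a₀ * b₀) * c₁ + (a₀ * b₁ + a₁ * b₀) * c₀ ≡ a₀ * (b₀ * c₁ + b₁ * c₀) + a₁ * (b₀ * c₀)
    l₁ = solve-∀
    l₂ : ∀ a₀ a₁ a₂ b₀ b₁ b₂ c₀ c₁ c₂ →
         ((a₀ * b₀) * c₂ + (a₀ * b₁ + a₁ * b₀) * c₁) + ((a₀ * b₂ + a₁ * b₁) + a₂ * b₀) * c₀
         ≡ (a₀ * ((b₀ * c₂ + b₁ * c₁) + b₂ * c₀) + a₁ * (b₀ * c₁ + b₁ * c₀)) + a₂ * (b₀ * c₀)
    l₂ = solve-∀

  ⊗-comm : ∀ x y → x ⊗ y ≡ y ⊗ x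
  ⊗-comm (a₀ , a₁ , a₂) (b₀ , b₁ , b₂) =
    triple-≡ (ℤ.*-comm a₀ b₀) (l₁ a₀ a₁ b₀ b₁) (l₂ a₀ a₁ a₂ b₀ b₁ b₂)
    where
    l₁ : ∀ a₀ a₁ b₀ b₁ → a₀ * b₁ + a₁ * b₀ ≡ b₀ * a₁ + b₁ * a₀
    l₁ = solve-∀
    l₂ : ∀ a₀ a₁ a₂ b₀ b₁ b₂ → (a₀ * b₂ + a₁ * b₁) + a₂ * b₀ ≡ (b₀ * a₂ + b₁ * a₁) + b₂ * a₀
    l₂ = solve-∀

  ⊗-identityˡ : ∀ x → 1₃ ⊗ x ≡ x
  ⊗-identityˡ (a₀ , a₁ , a₂) = triple-≡ (ℤ.*-identityˡ a₀) (l₁ a₀ a₁) (l₂ a₀ a₁ a₂)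
    where
    l₁ : ∀ a₀ a₁ → 1ℤ * a₁ + 0ℤ * a₀ ≡ a₁
    l₁ = solve-∀
    l₂ : ∀ a₀ a₁ a₂ → (1ℤ * a₂ + 0ℤ * a₁) + 0ℤ * a₀ ≡ a₂
    l₂ = solve-∀

  ⊗-isCommutativeMonoid : IsCommutativeMonoid _≡_ _⊗_ 1₃
  ⊗-isCommutativeMonoid = record
    { isMonoid = record
      { isSemigroup = record
        { isMagma = record { isEquivalence = isEquivalence ; ∙-cong = cong₂ _⊗_ }
        ; assoc   = ⊗-assoc
        }
      ; identity = ⊗-identityˡ , λ x → trans (⊗-comm x 1₃) (⊗-identityˡ x)
      }
    ; comm = ⊗-comm
    }

  open BigOperator ⊗-isCommutativeMonoid public using () renaming (big to prod₃)
  open BigOperator ⊗-isCommutativeMonoid using (big-suc)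

  coeff₀ coeff₁ coeff₂ : Trunc₃ → ℤ
  coeff₀ = proj₁
  coeff₁ x = proj₁ (proj₂ x)
  coeff₂ x = proj₂ (proj₂ x)

  risingFactorial₃ : ℕ → Trunc₃
  risingFactorial₃ n = prod₃ n (λ i → + suc i , 1ℤ , 0ℤ)

  risingFactorial₃-suc : ∀ n → risingFactorial₃ (suc n) ≡ risingFactorial₃ n ⊗ (+ suc n , 1ℤ , 0ℤ)
  risingFactorial₃-suc n = big-suc n (λ i → + suc i , 1ℤ , 0ℤ)

  coeff₀-risingFactorial₃ : ∀ n → coeff₀ (risingFactorial₃ n) ≡ + (n !)
  coeff₀-risingFactorial₃ zero    = refl
  coeff₀-risingFactorial₃ (suc n) = begin
      coeff₀ (risingFactorial₃ (suc n))
    ≡⟨ cong coeff₀ (risingFactorial₃-suc n) ⟩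
      coeff₀ (risingFactorial₃ n) * + suc n
    ≡⟨ cong (_* + suc n) (coeff₀-risingFactorial₃ n) ⟩
      + (n !) * + suc n
    ≡⟨ ℤ.*-comm (+ (n !)) (+ suc n) ⟩
      + suc n * + (n !)
    ≡⟨ sym (ℤ.pos-* (suc n) (n !)) ⟩
      + (suc n !)
    ∎
    where open ≡-Reasoning

  coeff₁-risingFactorial₃-suc : ∀ n →
    coeff₁ (risingFactorial₃ (suc n)) ≡ + (n !) + coeff₁ (risingFactorial₃ n) * + suc n
  coeff₁-risingFactorial₃-suc n =
    trans (cong coeff₁ (risingFactorial₃-suc n))
          (cong (_+ coeff₁ (risingFactorial₃ n) * + suc n)
                (trans (ℤ.*-identityʳ _) (coeff₀-risingFactorial₃ n)))

  coeff₂-risingFactorial₃-suc : ∀ n →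
    coeff₂ (risingFactorial₃ (suc n)) ≡ coeff₁ (risingFactorial₃ n) + coeff₂ (risingFactorial₃ n) * + suc n
  coeff₂-risingFactorial₃-suc n =
    trans (cong coeff₂ (risingFactorial₃-suc n))
          (cong (_+ coeff₂ (risingFactorial₃ n) * + suc n)
                (trans (cong (_+ coeff₁ (risingFactorial₃ n) * 1ℤ) (ℤ.*-zeroʳ (coeff₀ (risingFactorial₃ n))))
                       (trans (ℤ.+-identityˡ _) (ℤ.*-identityʳ (coeff₁ (risingFactorial₃ n))))))

  -- The image of a polynomial under X ↦ P t + t² in ℤ[t]/(t³).
  evalQuadratic : ℤ → List ℤ → Trunc₃
  evalQuadratic P cs = coeff 0 cs , P * coeff 1 cs , coeff 1 cs + (P * P) * coeff 2 cs

  prod₃-quadratic : ∀ P n f → prod₃ n (λ i → f i , P , 1ℤ) ≡ evalQuadratic P (linearProduct (applyUpTo f n))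
  prod₃-quadratic P zero    f = triple-≡ refl (sym (ℤ.*-zeroʳ P)) (lemma P)
    where
    lemma : ∀ P → 0ℤ ≡ 0ℤ + (P * P) * 0ℤ
    lemma = solve-∀
  prod₃-quadratic P (suc n) f =
    trans (cong ((f 0 , P , 1ℤ) ⊗_) (prod₃-quadratic P n (λ i → f (suc i))))
          (triple-≡ (trans (l₀ (f 0) (c 0)) (sym (coeff-linearProduct-∷ 0 (f 0) G)))
                    (trans (l₁ (f 0) P (c 0) (c 1)) (cong (P *_) (sym (coeff-linearProduct-∷ 1 (f 0) G))))
                    (trans (l₂ (f 0) P (c 0) (c 1) (c 2))
                           (sym (cong₂ (λ a b → a + (P * P) * b) (coeff-linearProduct-∷ 1 (f 0) G)
                                                                 (coeff-linearProduct-∷ 2 (f 0) G)))))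
    where
    G = applyUpTo (λ i → f (suc i)) n
    c : ℕ → ℤ
    c j = coeff j (linearProduct G)
    l₀ : ∀ z c₀ → z * c₀ ≡ z * c₀ + 0ℤ
    l₀ = solve-∀
    l₁ : ∀ z P c₀ c₁ → z * (P * c₁) + P * c₀ ≡ P * (z * c₁ + c₀)
    l₁ = solve-∀
    l₂ : ∀ z P c₀ c₁ c₂ →
         (z * (c₁ + (P * P) * c₂) + P * (P * c₁)) + 1ℤ * c₀ ≡ (z * c₁ + c₀) + (P * P) * (z * c₂ + c₁)
    l₂ = solve-∀

-- Rationals as fractions over a chosen denominator

module _ where

  open import Data.Integer using (+_; +[1+_]; _+_; _*_; -_)
  open import Data.Rational.Unnormalised as ℚᵘ using (ℚᵘ; mkℚᵘ; *≡*; _≃_)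
  open import Data.Integer.GCD using (gcd)
  import Data.Nat.Divisibility as ℕ

  -- x · d = a, where d need not be the reduced denominator of x.
  infix 4 _≃_÷_
  record _≃_÷_ (x : ℚ) (a d : ℤ) : Set where
    constructor ≃÷
    field cross : ℚᵘ.↥ (toℚᵘ x) * d ≡ a * ℚᵘ.↧ (toℚᵘ x)

  private
    swap : ∀ a b c → (a * b) * c ≡ (a * c) * b
    swap = solve-∀

    resp-≃ : ∀ x y a d → x ≃ y → ℚᵘ.↥ y * d ≡ a * ℚᵘ.↧ y → ℚᵘ.↥ x * d ≡ a * ℚᵘ.↧ x
    resp-≃ (mkℚᵘ n₁ d₁) (mkℚᵘ n₂ d₂) a d (*≡* n₁d₂≡n₂d₁) n₂d≡ad₂ =
      ℤ.*-cancelʳ-≡ (n₁ * d) (a * +[1+ d₁ ]) +[1+ d₂ ]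
        (trans (swap n₁ d +[1+ d₂ ]) (trans (cong (_* d) n₁d₂≡n₂d₁)
        (trans (swap n₂ +[1+ d₁ ] d) (trans (cong (_* +[1+ d₁ ]) n₂d≡ad₂) (swap a +[1+ d₂ ] +[1+ d₁ ])))))

    cross-+ : ∀ x y a b d → ℚᵘ.↥ x * d ≡ a * ℚᵘ.↧ x → ℚᵘ.↥ y * d ≡ b * ℚᵘ.↧ y →
              ℚᵘ.↥ (x ℚᵘ.+ y) * d ≡ (a + b) * ℚᵘ.↧ (x ℚᵘ.+ y)
    cross-+ (mkℚᵘ n₁ d₁) (mkℚᵘ n₂ d₂) a b d n₁d≡ad₁ n₂d≡bd₂ = begin
        (n₁ * D₂ + n₂ * D₁) * d
      ≡⟨ distrib n₁ n₂ D₁ D₂ d ⟩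
        (n₁ * d) * D₂ + (n₂ * d) * D₁
      ≡⟨ cong₂ (λ u v → u * D₂ + v * D₁) n₁d≡ad₁ n₂d≡bd₂ ⟩
        (a * D₁) * D₂ + (b * D₂) * D₁
      ≡⟨ collect a b D₁ D₂ ⟩
        (a + b) * (D₁ * D₂)
      ≡⟨ cong ((a + b) *_) (sym (ℤ.pos-* (suc d₁) (suc d₂))) ⟩
        (a + b) * + (suc d₁ ℕ.* suc d₂)
      ∎
      where
      open ≡-Reasoning
      D₁ = +[1+ d₁ ]
      D₂ = +[1+ d₂ ]
      distrib : ∀ n₁ n₂ D₁ D₂ d → (n₁ * D₂ + n₂ * D₁) * d ≡ (n₁ * d) * D₂ + (n₂ * d) * D₁
      distrib = solve-∀
      collect : ∀ a b D₁ D₂ → (a * D₁) * D₂ + (b * D₂) * D₁ ≡ (a + b) * (D₁ * D₂)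
      collect = solve-∀

    cross-* : ∀ x y a b d e → ℚᵘ.↥ x * d ≡ a * ℚᵘ.↧ x → ℚᵘ.↥ y * e ≡ b * ℚᵘ.↧ y →
              ℚᵘ.↥ (x ℚᵘ.* y) * (d * e) ≡ (a * b) * ℚᵘ.↧ (x ℚᵘ.* y)
    cross-* (mkℚᵘ n₁ d₁) (mkℚᵘ n₂ d₂) a b d e n₁d≡ad₁ n₂e≡be₂ =
      trans (interchange n₁ n₂ d e) (trans (cong₂ _*_ n₁d≡ad₁ n₂e≡be₂)
      (trans (interchange a +[1+ d₁ ] b +[1+ d₂ ]) (cong ((a * b) *_) (sym (ℤ.pos-* (suc d₁) (suc d₂))))))
      where
      interchange : ∀ a b c d → (a * b) * (c * d) ≡ (a * c) * (b * d)
      interchange = solve-∀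

    cross-neg : ∀ x a d → ℚᵘ.↥ x * d ≡ a * ℚᵘ.↧ x → ℚᵘ.↥ (ℚᵘ.- x) * d ≡ (- a) * ℚᵘ.↧ (ℚᵘ.- x)
    cross-neg (mkℚᵘ n _) a d nd≡ad′ =
      trans (sym (ℤ.neg-distribˡ-* n d)) (trans (cong -_ nd≡ad′) (ℤ.neg-distribˡ-* a _))

    cross-unique : ∀ x y a d .{{_ : ℤ.NonZero d}} →
                   ℚᵘ.↥ x * d ≡ a * ℚᵘ.↧ x → ℚᵘ.↥ y * d ≡ a * ℚᵘ.↧ y → x ≃ y
    cross-unique (mkℚᵘ n₁ d₁) (mkℚᵘ n₂ d₂) a d n₁d≡ad₁ n₂d≡ad₂ = *≡* (ℤ.*-cancelʳ-≡ _ _ d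
      (trans (swap n₁ +[1+ d₂ ] d) (trans (cong (_* +[1+ d₂ ]) n₁d≡ad₁)
      (trans (swap a +[1+ d₁ ] +[1+ d₂ ]) (trans (cong (_* +[1+ d₁ ]) (sym n₂d≡ad₂)) (swap n₂ d +[1+ d₁ ]))))))

  /-≃÷ : ∀ i d .{{_ : ℕ.NonZero d}} → i / d ≃ i ÷ + d
  /-≃÷ i (suc d) =
    ≃÷ (resp-≃ (toℚᵘ (i / suc d)) (mkℚᵘ i d) i (+ suc d) (ℚ.toℚᵘ-fromℚᵘ (mkℚᵘ i d)) refl)

  ≃÷-cong : ∀ {x a a′ d d′} → a ≡ a′ → d ≡ d′ → x ≃ a ÷ d → x ≃ a′ ÷ d′
  ≃÷-cong refl refl x≃a÷d = x≃a÷d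

  ≃÷-rescale : ∀ {x a d} e → x ≃ a ÷ d → x ≃ a * e ÷ d * e
  ≃÷-rescale {x} {a} {d} e (≃÷ xd≡a) =
    ≃÷ (trans (sym (ℤ.*-assoc (ℚᵘ.↥ (toℚᵘ x)) d e))
              (trans (cong (_* e) xd≡a) (swap a (ℚᵘ.↧ (toℚᵘ x)) e)))

  ≃÷-+ : ∀ {x y a b d} → x ≃ a ÷ d → y ≃ b ÷ d → x ℚ.+ y ≃ a + b ÷ d
  ≃÷-+ {x} {y} {a} {b} {d} (≃÷ xd≡a) (≃÷ yd≡b) =
    ≃÷ (resp-≃ (toℚᵘ (x ℚ.+ y)) _ (a + b) d (ℚ.toℚᵘ-homo-+ x y)
               (cross-+ (toℚᵘ x) (toℚᵘ y) a b d xd≡a yd≡b))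

  ≃÷-* : ∀ {x y a b d e} → x ≃ a ÷ d → y ≃ b ÷ e → x ℚ.* y ≃ a * b ÷ d * e
  ≃÷-* {x} {y} {a} {b} {d} {e} (≃÷ xd≡a) (≃÷ ye≡b) =
    ≃÷ (resp-≃ (toℚᵘ (x ℚ.* y)) _ (a * b) (d * e) (ℚ.toℚᵘ-homo-* x y)
               (cross-* (toℚᵘ x) (toℚᵘ y) a b d e xd≡a ye≡b))

  ≃÷-neg : ∀ {x a d} → x ≃ a ÷ d → ℚ.- x ≃ - a ÷ d
  ≃÷-neg {x} {a} {d} (≃÷ xd≡a) =
    ≃÷ (resp-≃ (toℚᵘ (ℚ.- x)) _ (- a) d (ℚ.toℚᵘ-homo‿- x) (cross-neg (toℚᵘ x) a d xd≡a))

  ≃÷-sub : ∀ {x y a b d} → x ≃ a ÷ d → y ≃ b ÷ d → x ℚ.- y ≃ a ℤ.- b ÷ d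
  ≃÷-sub x≃a÷d y≃b÷d = ≃÷-+ x≃a÷d (≃÷-neg y≃b÷d)

  ≃÷-unique : ∀ {x y a} d .{{_ : ℤ.NonZero d}} → x ≃ a ÷ d → y ≃ a ÷ d → x ≡ y
  ≃÷-unique {x} {y} {a} d (≃÷ xd≡a) (≃÷ yd≡a) =
    ℚ.toℚᵘ-injective (cross-unique (toℚᵘ x) (toℚᵘ y) a d xd≡a yd≡a)

  ≃÷-+-rescaled : ∀ {x y a b d e} d′ e′ {D} → d * d′ ≡ D → e * e′ ≡ D →
                  x ≃ a ÷ d → y ≃ b ÷ e → x ℚ.+ y ≃ a * d′ + b * e′ ÷ D
  ≃÷-+-rescaled d′ e′ dd′≡D ee′≡D x≃a÷d y≃b÷e =
    ≃÷-+ (≃÷-cong refl dd′≡D (≃÷-rescale d′ x≃a÷d)) (≃÷-cong refl ee′≡D (≃÷-rescale e′ y≃b÷e))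

  nℚ-*-≃÷ : ∀ n {x a d} → x ≃ a ÷ d → nℚ n ℚ.* x ≃ + n * a ÷ d
  nℚ-*-≃÷ n {d = d} x≃a÷d = ≃÷-cong refl (ℤ.*-identityˡ d) (≃÷-* (/-≃÷ (+ n) 1) x≃a÷d)

  pIntegral-/ : ∀ {p} i d .{{_ : ℕ.NonZero d}} → ¬ p ℕ.∣ d → pIntegral p (i / d)
  pIntegral-/ i d p∤d p∣↧ = p∤d (ℕ.∣-trans p∣↧ (ℕ.divides ℤ.∣ gcd i (+ d) ∣ ↧ₙ*∣gcd∣≡d))
    where
    ↧ₙ*∣gcd∣≡d : d ≡ ℤ.∣ gcd i (+ d) ∣ ℕ.* ℚ.↧ₙ (i / d)
    ↧ₙ*∣gcd∣≡d = sym (trans (ℕ.*-comm _ (ℚ.↧ₙ (i / d)))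
                     (trans (sym (ℤ.abs-* (ℚ.↧ (i / d)) (gcd i (+ d)))) (cong ℤ.∣_∣ (ℚ.↧-/ i d))))

module _ where

  open import Data.Integer using (+_; _+_; _*_)

  sumℚ-++ : ∀ xs ys → sumℚ (xs ++ ys) ≡ sumℚ xs ℚ.+ sumℚ ys
  sumℚ-++ []       ys = sym (ℚ.+-identityˡ _)
  sumℚ-++ (x ∷ xs) ys = trans (cong (x ℚ.+_) (sumℚ-++ xs ys)) (sym (ℚ.+-assoc x _ _))

  range-suc : ∀ a n → range a (suc n) ≡ range a n ++ (a ℕ.+ n ∷ [])
  range-suc a zero    = cong (_∷ []) (sym (ℕ.+-identityʳ a))
  range-suc a (suc n) =
    cong (a ∷_) (trans (range-suc (suc a) n) (cong (λ k → range (suc a) n ++ (k ∷ [])) (sym (ℕ.+-suc a n))))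

  sumℚ-oneTo-suc : ∀ (f : ℕ → ℚ) n → sumℚ (map f (oneTo (suc n))) ≡ sumℚ (map f (oneTo n)) ℚ.+ f (suc n)
  sumℚ-oneTo-suc f n = begin
      sumℚ (map f (oneTo (suc n)))
    ≡⟨ cong (λ l → sumℚ (map f l)) (range-suc 1 n) ⟩
      sumℚ (map f (oneTo n ++ (suc n ∷ [])))
    ≡⟨ cong sumℚ (List.map-++ f (oneTo n) (suc n ∷ [])) ⟩
      sumℚ (map f (oneTo n) ++ (f (suc n) ∷ []))
    ≡⟨ sumℚ-++ (map f (oneTo n)) (f (suc n) ∷ []) ⟩
      sumℚ (map f (oneTo n)) ℚ.+ (f (suc n) ℚ.+ ℚ.0ℚ)
    ≡⟨ cong (sumℚ (map f (oneTo n)) ℚ.+_) (ℚ.+-identityʳ (f (suc n))) ⟩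
      sumℚ (map f (oneTo n)) ℚ.+ f (suc n)
    ∎
    where open ≡-Reasoning

  harmonicOver : ℕ → ℕ → ℚ
  harmonicOver j n = sumℚ (map (λ i → + 1 / suc (ℕ.pred (i ℕ.* j))) (oneTo n))

  pairSum-suc : ∀ n → pairSum (suc n) ≡ pairSum n ℚ.+ harmonicOver (suc n) n
  pairSum-suc n = begin
      sumℚ (concatMap F (oneTo (suc n)))
    ≡⟨ cong (λ l → sumℚ (concatMap F l)) (range-suc 1 n) ⟩
      sumℚ (concat (map F (oneTo n ++ (suc n ∷ []))))
    ≡⟨ cong (λ l → sumℚ (concat l)) (List.map-++ F (oneTo n) (suc n ∷ [])) ⟩
      sumℚ (concat (map F (oneTo n) ++ (F (suc n) ∷ [])))
    ≡⟨ cong sumℚ (sym (List.concat-++ (map F (oneTo n)) (F (suc n) ∷ []))) ⟩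
      sumℚ (concatMap F (oneTo n) ++ (F (suc n) ++ []))
    ≡⟨ sumℚ-++ (concatMap F (oneTo n)) (F (suc n) ++ []) ⟩
      pairSum n ℚ.+ sumℚ (F (suc n) ++ [])
    ≡⟨ cong (λ l → pairSum n ℚ.+ sumℚ l) (List.++-identityʳ (F (suc n))) ⟩
      pairSum n ℚ.+ harmonicOver (suc n) n
    ∎
    where
    open ≡-Reasoning
    F : ℕ → List ℚ
    F j = map (λ i → + 1 / suc (ℕ.pred (i ℕ.* j))) (oneTo (ℕ.pred j))

  private
    factorial-suc : ∀ n → + (suc n !) ≡ + suc n * + (n !)
    factorial-suc n = ℤ.pos-* (suc n) (n !)

    numerator-suc : ∀ n → coeff₁ (risingFactorial₃ n) * + suc n + + 1 * + (n !) ≡ coeff₁ (risingFactorial₃ (suc n))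
    numerator-suc n = trans (lemma (coeff₁ (risingFactorial₃ n)) (+ suc n) (+ (n !)))
                            (sym (coeff₁-risingFactorial₃-suc n))
      where
      lemma : ∀ a s f → a * s + + 1 * f ≡ f + a * s
      lemma = solve-∀

  harmonic-≃÷ : ∀ n → harmonic n ≃ coeff₁ (risingFactorial₃ n) ÷ + (n !)
  harmonic-≃÷ zero    = /-≃÷ (+ 0) 1
  harmonic-≃÷ (suc n) =
    subst (_≃ coeff₁ (risingFactorial₃ (suc n)) ÷ + (suc n !)) (sym (sumℚ-oneTo-suc _ n))
      (≃÷-cong (numerator-suc n) refl
        (≃÷-+-rescaled (+ suc n) (+ (n !))
          (trans (ℤ.*-comm (+ (n !)) (+ suc n)) (sym (factorial-suc n))) (sym (factorial-suc n))
          (harmonic-≃÷ n) (/-≃÷ (+ 1) (suc n))))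

  harmonicOver-≃÷ : ∀ c n → harmonicOver (suc c) n ≃ coeff₁ (risingFactorial₃ n) ÷ + (n !) * + suc c
  harmonicOver-≃÷ c zero    = ≃÷ refl
  harmonicOver-≃÷ c (suc n) =
    subst (_≃ coeff₁ (risingFactorial₃ (suc n)) ÷ + (suc n !) * + suc c) (sym (sumℚ-oneTo-suc _ n))
      (≃÷-cong (numerator-suc n) refl
        (≃÷-+-rescaled (+ suc n) (+ (n !)) denominator (trans (swap S C N) denominator)
          (harmonicOver-≃÷ c n) (≃÷-cong refl (ℤ.pos-* (suc n) (suc c)) (/-≃÷ (+ 1) (suc n ℕ.* suc c)))))
    where
    N = + (n !)
    S = + suc n
    C = + suc c
    swap : ∀ S C N → (S * C) * N ≡ (N * C) * S
    swap = solve-∀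
    rotate : ∀ N C S → (N * C) * S ≡ (S * N) * C
    rotate = solve-∀
    denominator : (N * C) * S ≡ + (suc n !) * C
    denominator = trans (rotate N C S) (cong (_* C) (sym (factorial-suc n)))

  pairSum-≃÷ : ∀ n → pairSum n ≃ coeff₂ (risingFactorial₃ n) ÷ + (n !)
  pairSum-≃÷ zero    = /-≃÷ (+ 0) 1
  pairSum-≃÷ (suc n) =
    subst (_≃ coeff₂ (risingFactorial₃ (suc n)) ÷ + (suc n !)) (sym (pairSum-suc n))
      (≃÷-cong numerator refl
        (≃÷-+-rescaled (+ suc n) 1ℤ
          (trans (ℤ.*-comm (+ (n !)) (+ suc n)) (sym (factorial-suc n)))
          (trans (ℤ.*-identityʳ (+ (n !) * + suc n)) (trans (ℤ.*-comm (+ (n !)) (+ suc n)) (sym (factorial-suc n))))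
          (pairSum-≃÷ n) (harmonicOver-≃÷ n n)))
    where
    numerator : coeff₂ (risingFactorial₃ n) * + suc n + coeff₁ (risingFactorial₃ n) * 1ℤ
              ≡ coeff₂ (risingFactorial₃ (suc n))
    numerator = trans (lemma (coeff₂ (risingFactorial₃ n)) (+ suc n) (coeff₁ (risingFactorial₃ n)))
                      (sym (coeff₂-risingFactorial₃-suc n))
      where
      lemma : ∀ b s a → b * s + a * 1ℤ ≡ a + b * s
      lemma = solve-∀

-- The congruence for p = 2m + 1

module OddPrime (m : ℕ) (prime : Prime (suc (m ℕ.+ m))) (4≤m : 4 ≤ m) where

  open import Data.Integer using (+_; _+_; _-_; _*_; -_; _^_)
  open import Data.Integer.Divisibility.Signed using (_∣_; divides; quotient; ∣ᵤ⇒∣; ∣n⇒∣m*n)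
  open import Data.Nat.Combinatorics using (_C_)
  import Data.Nat.Divisibility as ℕ

  q p : ℕ
  q = m ℕ.+ m
  p = suc q

  P : ℤ
  P = + p

  3≤m : 3 ≤ m
  3≤m = ℕ.≤-trans (ℕ.n≤1+n 3) 4≤m

  k : ℕ → ℤ
  k i = + suc i

  k-mirror : ∀ i → i < m → k (q ℕ.∸ suc i) ≡ P - k i
  k-mirror i i<m = begin
      + suc (q ℕ.∸ suc i)
    ≡⟨ cong +_ (sym (ℕ.+-∸-assoc 1 i<q)) ⟩
      + (p ℕ.∸ suc i)
    ≡⟨ sym (ℤ.⊖-≥ (ℕ.<-trans i<q (ℕ.n<1+n q))) ⟩
      p ℤ.⊖ suc i
    ≡⟨ sym (ℤ.m-n≡m⊖n p (suc i)) ⟩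
      P - k i
    ∎
    where
    open ≡-Reasoning
    i<q : i < q
    i<q = ℕ.≤-trans i<m (ℕ.m≤m+n m m)

  k-mirror≡-k : ∀ i → i < m → k (q ℕ.∸ suc i) ≡ - k i mod P
  k-mirror≡-k i i<m = mk≡mod (divides 1ℤ (trans (cong (_- - k i) (k-mirror i i<m)) (lemma P (k i))))
    where
    lemma : ∀ P k → (P - k) - - k ≡ 1ℤ * P
    lemma = solve-∀

  z : ℕ → ℤ
  z i = k i * (P - k i)

  z≡-k² : ∀ i → z i ≡ - (k i * k i) mod P
  z≡-k² i = mk≡mod (divides (k i) (lemma (k i) P))
    where
    lemma : ∀ k P → k * (P - k) - - (k * k) ≡ k * P
    lemma = solve-∀

  private
    module Σℤ = BigOperator ℤ.+-0-isCommutativeMonoid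
    module Πℤ = BigOperator ℤ.*-1-isCommutativeMonoid
    module Π₃ = BigOperator ⊗-isCommutativeMonoid

  squareSum : ℕ → ℤ
  squareSum r = sumℤ m (λ i → (k i * k i) ^ r)

  powerSum-mirrored : ∀ r → + powerSum (suc r) p ≡ sumℤ m (λ i → k i ^ suc r + k (q ℕ.∸ suc i) ^ suc r)
  powerSum-mirrored r = begin
      + sumℕ p (λ j → j ℕ.^ suc r)
    ≡⟨ big-homomorphic ℕ.+-0-isCommutativeMonoid ℤ.+-0-isCommutativeMonoid +_ refl ℤ.pos-+ p (λ j → j ℕ.^ suc r) ⟩
      sumℤ p (λ j → + (j ℕ.^ suc r))
    ≡⟨ Σℤ.big-cong p (λ j _ → pos-^ j (suc r)) ⟩
      0ℤ + sumℤ q (λ i → k i ^ suc r)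
    ≡⟨ ℤ.+-identityˡ _ ⟩
      sumℤ q (λ i → k i ^ suc r)
    ≡⟨ Σℤ.big-pairEnds m (λ i → k i ^ suc r) ⟩
      sumℤ m (λ i → k i ^ suc r + k (q ℕ.∸ suc i) ^ suc r)
    ∎
    where open ≡-Reasoning

  powerSum≡2*squareSum : ∀ r → 1 ≤ r → + powerSum (r ℕ.+ r) p ≡ + 2 * squareSum r mod P
  powerSum≡2*squareSum r@(suc r′) _ = begin
      + powerSum (r ℕ.+ r) p
    ≡⟨ powerSum-mirrored (r′ ℕ.+ r) ⟩
      sumℤ m (λ i → k i ^ (r ℕ.+ r) + k (q ℕ.∸ suc i) ^ (r ℕ.+ r))
    ≈⟨ mod-sum m term ⟩
      sumℤ m (λ i → + 2 * (k i * k i) ^ r)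
    ≡⟨ sumℤ-*ˡ m (+ 2) (λ i → (k i * k i) ^ r) ⟩
      + 2 * squareSum r
    ∎
    where
    open ≡-mod-Reasoning P
    square-neg : ∀ k → - k * - k ≡ k * k
    square-neg = solve-∀
    double : ∀ x → x + x ≡ + 2 * x
    double = solve-∀
    term : ∀ i → i < m → k i ^ (r ℕ.+ r) + k (q ℕ.∸ suc i) ^ (r ℕ.+ r) ≡ + 2 * (k i * k i) ^ r mod P
    term i i<m = begin
        k i ^ (r ℕ.+ r) + k (q ℕ.∸ suc i) ^ (r ℕ.+ r)
      ≈⟨ mod-+ (≡⇒≡-mod (^-double (k i) r)) (mod-^ (r ℕ.+ r) (k-mirror≡-k i i<m)) ⟩
        (k i * k i) ^ r + (- k i) ^ (r ℕ.+ r)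
      ≡⟨ cong (_+_ ((k i * k i) ^ r)) (trans (^-double (- k i) r) (cong (_^ r) (square-neg (k i)))) ⟩
        (k i * k i) ^ r + (k i * k i) ^ r
      ≡⟨ double ((k i * k i) ^ r) ⟩
        + 2 * (k i * k i) ^ r
      ∎

  p∤2 : ¬ p ℕ.∣ 2
  p∤2 = ℕ.>⇒∤ (s≤s (ℕ.≤-trans (ℕ.≤-trans (ℕ.n≤1+n 2) 3≤m) (ℕ.m≤m+n m m)))

  p∣squareSum : ∀ r → 1 ≤ r → r < m → P ∣ squareSum r
  p∣squareSum r 1≤r r<m = prime∣*-cancelˡ-ℤ prime p∤2 (≡0-mod⇒∣ (begin
      + 2 * squareSum r
    ≈⟨ mod-sym (powerSum≡2*squareSum r 1≤r) ⟩
      + powerSum (r ℕ.+ r) p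
    ≈⟨ ∣⇒≡0-mod (∣ᵤ⇒∣ (prime∣powerSum prime (r ℕ.+ r) (s≤s (ℕ.+-mono-< r<m r<m)))) ⟩
      0ℤ
    ∎))
    where open ≡-mod-Reasoning P

  zs : List ℤ
  zs = applyUpTo z m

  p∣powerSumOf-zs : ∀ r → 1 ≤ r → r < m → P ∣ powerSumOf zs r
  p∣powerSumOf-zs r 1≤r r<m = subst (P ∣_) (sym (powerSumOf-applyUpTo m z r)) (≡0-mod⇒∣ (begin
      sumℤ m (λ i → z i ^ r)
    ≈⟨ mod-sum m (λ i _ → mod-^ r (z≡-k² i)) ⟩
      sumℤ m (λ i → (- (k i * k i)) ^ r)
    ≡⟨ Σℤ.big-cong m (λ i _ → neg-^ (k i * k i)) ⟩
      sumℤ m (λ i → (- 1ℤ) ^ r * (k i * k i) ^ r)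
    ≡⟨ sumℤ-*ˡ m ((- 1ℤ) ^ r) (λ i → (k i * k i) ^ r) ⟩
      (- 1ℤ) ^ r * squareSum r
    ≈⟨ ∣⇒≡0-mod (∣n⇒∣m*n ((- 1ℤ) ^ r) (p∣squareSum r 1≤r r<m)) ⟩
      0ℤ
    ∎))
    where
    open ≡-mod-Reasoning P
    neg-^ : ∀ x → (- x) ^ r ≡ (- 1ℤ) ^ r * x ^ r
    neg-^ x = trans (cong (_^ r) (sym (ℤ.-1*i≡-i x))) (^-distribʳ-* (- 1ℤ) x r)

  G : List ℤ
  G = linearProduct zs

  c : ℕ → ℤ
  c j = coeff j G

  c₃≡elementary : c 3 ≡ elementary zs (m ℕ.∸ 3)
  c₃≡elementary = begin
      coeff 3 G
    ≡⟨ cong (λ j → coeff j G) (sym (ℕ.m∸[m∸n]≡n 3≤m)) ⟩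
      coeff (m ℕ.∸ (m ℕ.∸ 3)) G
    ≡⟨ cong (λ n → coeff (n ℕ.∸ (m ℕ.∸ 3)) G) (sym length-zs) ⟩
      coeff (length zs ℕ.∸ (m ℕ.∸ 3)) G
    ≡⟨ coeff-linearProduct zs (m ℕ.∸ 3) (subst (m ℕ.∸ 3 ≤_) (sym length-zs) (ℕ.m∸n≤m m 3)) ⟩
      elementary zs (m ℕ.∸ 3)
    ∎
    where
    open ≡-Reasoning
    length-zs : length zs ≡ m
    length-zs = List.length-applyUpTo z m

  p∣c₃ : P ∣ c 3
  p∣c₃ = subst (P ∣_) (sym c₃≡elementary)
    (prime∣elementary prime zs (m ℕ.∸ 3) J<p (λ i 1≤i i≤J → p∣powerSumOf-zs i 1≤i (ℕ.≤-<-trans i≤J J<m))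
                      (m ℕ.∸ 3) 1≤J ℕ.≤-refl)
    where
    J<m : m ℕ.∸ 3 < m
    J<m = ℕ.∸-monoʳ-< {o = 0} (s≤s z≤n) 3≤m
    J<p : m ℕ.∸ 3 < p
    J<p = ℕ.<-trans J<m (s≤s (ℕ.m≤m+n m m))
    1≤J : 1 ≤ m ℕ.∸ 3
    1≤J = ℕ.∸-monoˡ-≤ 3 4≤m

  V : ℤ
  V = + 2 * (P * P)

  centralBinomial : ℕ
  centralBinomial = (2 ℕ.* p ℕ.∸ 1) C (p ℕ.∸ 1)

  -- q! · C(p + q, q) = (p + 1)(p + 2) ⋯ (p + q), and pairing the factors p + i and 2p − i gives V + z.
  factorial*centralBinomial≡eval : + (centralBinomial ℕ.* q !) ≡ eval G V
  factorial*centralBinomial≡eval = begin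
      + (centralBinomial ℕ.* q !)
    ≡⟨ cong (λ n → + ((n C q) ℕ.* q !)) 2p-1≡p+q ⟩
      + (((p ℕ.+ q) C q) ℕ.* q !)
    ≡⟨ cong +_ (binomial-prodℕ p q) ⟩
      + prodℕ q (λ i → p ℕ.+ suc i)
    ≡⟨ big-homomorphic ℕ.*-1-isCommutativeMonoid ℤ.*-1-isCommutativeMonoid +_ refl ℤ.pos-* q (λ i → p ℕ.+ suc i) ⟩
      prodℤ q (λ i → + (p ℕ.+ suc i))
    ≡⟨ Πℤ.big-cong q (λ i _ → ℤ.pos-+ p (suc i)) ⟩
      prodℤ q (λ i → P + k i)
    ≡⟨ Πℤ.big-pairEnds m (λ i → P + k i) ⟩
      prodℤ m (λ i → (P + k i) * (P + k (q ℕ.∸ suc i)))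
    ≡⟨ Πℤ.big-cong m (λ i i<m → trans (cong (λ x → (P + k i) * (P + x)) (k-mirror i i<m)) (pair (k i) P)) ⟩
      prodℤ m (λ i → V + z i)
    ≡⟨ sym (eval-linearProduct m z V) ⟩
      eval G V
    ∎
    where
    open ≡-Reasoning
    2p-1≡p+q : 2 ℕ.* p ℕ.∸ 1 ≡ p ℕ.+ q
    2p-1≡p+q = trans (cong (q ℕ.+_) (ℕ.+-identityʳ p)) (ℕ.+-suc q q)
    pair : ∀ x P → (P + x) * (P + (P - x)) ≡ + 2 * (P * P) + x * (P - x)
    pair = solve-∀

  -- (i + t)(p − i + t) = z + p t + t²
  risingFactorial₃≡evalQuadratic : risingFactorial₃ q ≡ evalQuadratic P G
  risingFactorial₃≡evalQuadratic =
    trans (Π₃.big-pairEnds m (λ i → k i , 1ℤ , 0ℤ))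
          (trans (Π₃.big-cong m pair) (prod₃-quadratic P m z))
    where
    linear : ∀ k P → k * 1ℤ + 1ℤ * (P - k) ≡ P
    linear = solve-∀
    quadratic : ∀ k P → (k * 0ℤ + 1ℤ * 1ℤ) + 0ℤ * (P - k) ≡ 1ℤ
    quadratic = solve-∀
    pair : ∀ i → i < m → (k i , 1ℤ , 0ℤ) ⊗ (k (q ℕ.∸ suc i) , 1ℤ , 0ℤ) ≡ (z i , P , 1ℤ)
    pair i i<m = trans (cong (λ x → (k i , 1ℤ , 0ℤ) ⊗ (x , 1ℤ , 0ℤ)) (k-mirror i i<m))
                       (cong (z i ,_) (cong₂ _,_ (linear (k i) P) (quadratic (k i) P)))

  Q a₁ a₂ : ℤ
  Q = + (q !)
  a₁ = coeff₁ (risingFactorial₃ q)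
  a₂ = coeff₂ (risingFactorial₃ q)

  numerator : ℤ
  numerator = (Q - + (2 ℕ.* p) * a₁) + + (4 ℕ.* p ℕ.^ 2) * a₂

  R : ℤ
  R = eval (drop 4 G) V

  K : ℤ
  K = + 8 * quotient p∣c₃ + + 16 * (P * R)

  Q≡c₀ : Q ≡ c 0
  Q≡c₀ = trans (sym (coeff₀-risingFactorial₃ q)) (cong coeff₀ risingFactorial₃≡evalQuadratic)

  -- With Q = c₀, a₁ = P c₁ and a₂ = c₁ + P² c₂ the terms of degree < 3 in V = 2P² cancel,
  -- and the remaining V³ c₃ + V⁴ R is divisible by P⁷ because P ∣ c₃.
  Q*centralBinomial-numerator : Q * + centralBinomial - numerator ≡ + (p ℕ.^ 7) * K
  Q*centralBinomial-numerator = begin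
      Q * + centralBinomial - numerator
    ≡⟨ cong (_- numerator) (trans (ℤ.*-comm Q (+ centralBinomial)) (sym (ℤ.pos-* centralBinomial (q !)))) ⟩
      + (centralBinomial ℕ.* q !) - numerator
    ≡⟨ cong (_- numerator) (trans factorial*centralBinomial≡eval (eval-split₄ G V)) ⟩
      (c 0 + V * (c 1 + V * (c 2 + V * (c 3 + V * R)))) - numerator
    ≡⟨ cong₂ (λ c₃ n → (c 0 + V * (c 1 + V * (c 2 + V * (c₃ + V * R)))) - n) (_∣_.equality p∣c₃) numerator≡ ⟩
      (c 0 + V * (c 1 + V * (c 2 + V * (quotient p∣c₃ * P + V * R))))
        - ((c 0 - (+ 2 * P) * (P * c 1)) + (+ 4 * P ^ 2) * (c 1 + (P * P) * c 2))
    ≡⟨ collect (c 0) (c 1) (c 2) (quotient p∣c₃) R P ⟩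
      (P * (P * (P * (P * (P * (P * (P * 1ℤ))))))) * K
    ≡⟨ cong (_* K) (sym (pos-^ p 7)) ⟩
      + (p ℕ.^ 7) * K
    ∎
    where
    open ≡-Reasoning
    numerator≡ : numerator ≡ (c 0 - (+ 2 * P) * (P * c 1)) + (+ 4 * P ^ 2) * (c 1 + (P * P) * c 2)
    numerator≡ = begin
        (Q - + (2 ℕ.* p) * a₁) + + (4 ℕ.* p ℕ.^ 2) * a₂
      ≡⟨ cong₂ (λ x y → (x - + (2 ℕ.* p) * a₁) + y * a₂) Q≡c₀ (trans (ℤ.pos-* 4 (p ℕ.^ 2)) (cong (+ 4 *_) (pos-^ p 2))) ⟩
        (c 0 - + (2 ℕ.* p) * a₁) + (+ 4 * P ^ 2) * a₂
      ≡⟨ cong₂ (λ x y → (c 0 - x * coeff₁ y) + (+ 4 * P ^ 2) * coeff₂ y) (ℤ.pos-* 2 p) risingFactorial₃≡evalQuadratic ⟩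
        (c 0 - (+ 2 * P) * (P * c 1)) + (+ 4 * P ^ 2) * (c 1 + (P * P) * c 2)
      ∎
    collect : ∀ c₀ c₁ c₂ t R P →
      (c₀ + (+ 2 * (P * P)) * (c₁ + (+ 2 * (P * P)) * (c₂ + (+ 2 * (P * P)) * (t * P + (+ 2 * (P * P)) * R))))
        - ((c₀ - (+ 2 * P) * (P * c₁)) + (+ 4 * (P * (P * 1ℤ))) * (c₁ + (P * P) * c₂))
      ≡ (P * (P * (P * (P * (P * (P * (P * 1ℤ))))))) * (+ 8 * t + + 16 * (P * R))
    collect = solve-∀

  RHS : ℚ
  RHS = (1ℚ ℚ.- nℚ (2 ℕ.* p) ℚ.* harmonic (p ℕ.∸ 1)) ℚ.+ nℚ (4 ℕ.* p ℕ.^ 2) ℚ.* pairSum (p ℕ.∸ 1)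

  instance
    q!≢0 : ℕ.NonZero (q !)
    q!≢0 = ℕ._!≢0 q

  Q≢0 : ℤ.NonZero Q
  Q≢0 = ℕ._!≢0 q

  RHS≃numerator÷Q : RHS ≃ numerator ÷ Q
  RHS≃numerator÷Q =
    ≃÷-+ (≃÷-sub 1≃Q÷Q (nℚ-*-≃÷ (2 ℕ.* p) (harmonic-≃÷ q))) (nℚ-*-≃÷ (4 ℕ.* p ℕ.^ 2) (pairSum-≃÷ q))
    where
    1≃Q÷Q : 1ℚ ≃ Q ÷ Q
    1≃Q÷Q = ≃÷-cong (ℤ.*-identityˡ Q) (ℤ.*-identityˡ Q) (≃÷-rescale Q (/-≃÷ 1ℤ 1))

  difference≃ : nℚ centralBinomial ℚ.- RHS ≃ + (p ℕ.^ 7) * K ÷ Q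
  difference≃ = ≃÷-cong Q*centralBinomial-numerator refl
    (≃÷-sub (≃÷-cong (ℤ.*-comm (+ centralBinomial) Q) (ℤ.*-identityˡ Q) (≃÷-rescale Q (/-≃÷ (+ centralBinomial) 1)))
          RHS≃numerator÷Q)

  difference≡ : nℚ centralBinomial ℚ.- RHS ≡ nℚ (p ℕ.^ 7) ℚ.* (K / q !)
  difference≡ = ≃÷-unique Q {{Q≢0}} difference≃ (nℚ-*-≃÷ (p ℕ.^ 7) (/-≃÷ K (q !)))

  RHS≡ : RHS ≡ numerator / q !
  RHS≡ = ≃÷-unique Q {{Q≢0}} RHS≃numerator÷Q (/-≃÷ numerator (q !))

  p∤1 : ¬ p ℕ.∣ 1
  p∤1 = ℕ.>⇒∤ (ℕ.nonTrivial⇒n>1 p {{prime⇒nonTrivial prime}})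

  p∤q! : ¬ p ℕ.∣ q !
  p∤q! = prime∤factorial prime q (ℕ.n<1+n q)

  congruence : CongModPow p 7 (nℚ centralBinomial) RHS
  congruence = pIntegral-/ (+ centralBinomial) 1 p∤1
             , subst (pIntegral p) (sym RHS≡) (pIntegral-/ numerator (q !) p∤q!)
             , K / q !
             , pIntegral-/ K (q !) p∤q!
             , difference≡

open import Data.Nat using (_*_; _∸_; _^_)
open import Data.Nat.Combinatorics using (_C_)
open import Data.Rational using (_+_; _-_)

theorem1p1 : (p : ℕ) → Prime p → 11 ≤ p →
    CongModPow p 7 (nℚ ((2 * p ∸ 1) C (p ∸ 1)))
      ((ℚ.1ℚ - nℚ (2 * p) ℚ.* harmonic (p ∸ 1)) + nℚ (4 * p ^ 2) ℚ.* pairSum (p ∸ 1))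
theorem1p1 p pr 11≤p with odd-prime pr (ℕ.<-≤-trans (s≤s (s≤s (s≤s z≤n))) 11≤p)
... | m , refl = OddPrime.congruence m pr 4≤m
  where
  4≤m : 4 ≤ m
  4≤m = ℕ.≮⇒≥ (λ m<4 → ℕ.<⇒≱ (ℕ.+-mono-< m<4 m<4) (ℕ.≤-trans (ℕ.m≤n+m 8 2) (ℕ.≤-pred 11≤p)))
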